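{- Let $n\ge 2$ and let $P$ be a set of $2n$ points in regular wheel configuration. Suppose $T_1,\dots,T_n$ are plane spanning trees on $P$ whose edge sets partition the edge set of $GW_{2n}$. Then there is a unique tree $T\in\{T_1,\dots,T_n\}$ such that (i) $T$ has exactly one boundary edge and exactly $n$ radial edges, these joining the centre $x$ to $n$ points that are consecutive (in cyclic order) on $C$, and (ii) each tree in $\{T_1,\dots,T_n\}\setminus\{T\}$ has exactly two boundary edges and exactly one radial edge.
   Context: A set $P$ of $2n$ points is in regular wheel configuration if $2n-1$ of its points are the vertices of a regular $(2n-1)$-gon inscribed in a circle $C$ and the remaining point $x$ is the centre of $C$. $GW_{2n}$ is the complete geometric graph on $P$ (all pairs joined by straight-line segments). A plane spanning tree on $P$ is a spanning tree of $GW_{2n}$ whose edges pairwise do not cross (meet only at common endpoints). A boundary edge is an edge joining two points consecutive on $C$; a radial edge is an edge incident to $x$. Edge sets partition $E(GW_{2n})$ if they are pairwise disjoint with union $E(GW_{2n})$. -}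

module Defs where

open import Data.Nat using (ℕ; zero; suc; _+_; _∸_; _<_; _≤_; pred)
open import Data.Nat.DivMod using (_%_; _mod_)
open import Data.Fin using (Fin; toℕ)
open import Data.List using (List; []; _∷_; _++_; [_]; length)
open import Data.List.Membership.Propositional using (_∈_)
open import Data.List.Relation.Unary.Unique.Propositional using (Unique)
open import Data.List.Relation.Unary.Linked using (Linked)
open import Data.Product using (Σ; _×_; _,_)
open import Data.Sum using (_⊎_)
open import Data.Empty using (⊥)
open import Data.Unit using (⊤)
open import Relation.Binary.PropositionalEquality using (_≡_)
open import Relation.Binary.Construct.Closure.ReflexiveTransitive using (Star)
open import Relation.Nullary using (¬_)
open import Function.Bundles using (_⇔_)

-- The regular wheel configuration on 2n points.
-- Rim points: the vertices of the regular (2n-1)-gon, labelled by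
-- Fin (m n) in cyclic order, where m n = 2n-1 (for n ≥ 1).

m : ℕ → ℕ
m n = suc (pred n + pred n)

data Point (n : ℕ) : Set where
  centre : Point n
  rim    : Fin (m n) → Point n

shift : ∀ n → Fin (m n) → ℕ → Fin (m n)
shift n a t = (toℕ a + t) mod (m n)

pos : ∀ n → Fin (m n) → Fin (m n) → ℕ
pos n a v = (toℕ v + (m n ∸ toℕ a)) % (m n)

-- Edges of GW_{2n}, each unordered pair of points represented exactly once:
--   rad v       : the segment x–v
--   chord a d   : the segment joining rim a and rim (a + (d+1)), where
--                 1 ≤ d+1 ≤ n-1.  Since 2n-1 is odd, every pair of rim
--                 points has exactly one such representation (the
--                 clockwise offset along the shorter arc).

data Edge (n : ℕ) : Set where
  rad   : Fin (m n) → Edge n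
  chord : Fin (m n) → Fin (pred n) → Edge n

offset : ∀ n → Fin (pred n) → ℕ
offset n d = suc (toℕ d)

end₁ end₂ : ∀ {n} → Edge n → Point n
end₁ (rad v)     = centre
end₁ (chord a d) = rim a
end₂ (rad v)     = rim v
end₂ {n} (chord a d) = rim (shift n a (offset n d))

IsBoundary : ∀ {n} → Edge n → Set
IsBoundary (rad v)     = ⊥
IsBoundary (chord a d) = toℕ d ≡ 0

IsRadial : ∀ {n} → Edge n → Set
IsRadial (rad v)     = ⊤
IsRadial (chord a d) = ⊥

-- Geometric crossing (the two segments share a point that is not a
-- common endpoint).  For the chord rim a – rim (a+off), the rim vertex v
-- lies strictly inside the short arc iff 0 < pos a v < off and strictly
-- inside the long arc iff off < pos a v.  The centre lies strictly on
-- the long-arc side (no chord is a diameter since 2n-1 is odd).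

StrictIn StrictOut : ∀ {n} → Fin (m n) → Fin (pred n) → Fin (m n) → Set
StrictIn  {n} a d v = (0 < pos n a v) × (pos n a v < offset n d)
StrictOut {n} a d v = offset n d < pos n a v

Cross : ∀ {n} → Edge n → Edge n → Set
Cross (rad v)     (rad w)     = ⊥                 -- meet only at x
Cross {n} (rad v)     (chord a d) = StrictIn {n} a d v
Cross {n} (chord a d) (rad v)     = StrictIn {n} a d v
Cross {n} (chord a d) (chord c e) =
  (StrictIn {n} a d c × StrictOut {n} a d (shift n c (offset n e))) ⊎
  (StrictOut {n} a d c × StrictIn {n} a d (shift n c (offset n e)))

EdgeSet : ℕ → Set₁
EdgeSet n = Edge n → Set

Adj : ∀ {n} → EdgeSet n → Point n → Point n → Set
Adj {n} S u v = Σ (Edge n) λ e → S e ×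
  (((end₁ e ≡ u) × (end₂ e ≡ v)) ⊎ ((end₁ e ≡ v) × (end₂ e ≡ u)))

Connected : ∀ {n} → EdgeSet n → Set
Connected S = ∀ u v → Star (Adj S) u v

-- a cycle: distinct vertices v, w₁, …, w_k, w with k ≥ 1 (length ≥ 3),
-- consecutive ones adjacent, and w adjacent to v
HasCycle : ∀ {n} → EdgeSet n → Set
HasCycle {n} S = Σ (Point n) λ v → Σ (List (Point n)) λ ws → Σ (Point n) λ w →
  (1 ≤ length ws) × Unique (v ∷ ws ++ [ w ]) ×
  Linked (Adj S) (v ∷ ws ++ [ w ]) × Adj S w v

IsSpanningTree : ∀ {n} → EdgeSet n → Set
IsSpanningTree S = Connected S × ¬ HasCycle S

IsPlane : ∀ {n} → EdgeSet n → Set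
IsPlane S = ∀ e f → S e → S f → ¬ Cross e f

IsPlaneSpanningTree : ∀ {n} → EdgeSet n → Set
IsPlaneSpanningTree S = IsPlane S × IsSpanningTree S

Partition : ∀ {n} → (Fin n → EdgeSet n) → Set
Partition {n} T = ∀ e → Σ (Fin n) λ i → T i e × (∀ j → T j e → j ≡ i)

HasCard : {A : Set} → (A → Set) → ℕ → Set
HasCard {A} P k = Σ (List A) λ xs →
  Unique xs × (length xs ≡ k) × (∀ a → (a ∈ xs) ⇔ P a)

NumBoundary NumRadial : ∀ {n} → EdgeSet n → ℕ → Set
NumBoundary S k = HasCard (λ e → S e × IsBoundary e) k
NumRadial   S k = HasCard (λ e → S e × IsRadial e) k

SpecialTree : ∀ {n} → EdgeSet n → Set
SpecialTree {n} S = NumBoundary S 1 × NumRadial S n ×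
  Σ (Fin (m n)) λ a → ∀ v → S (rad v) ⇔ (pos n a v < n)

OrdinaryTree : ∀ {n} → EdgeSet n → Set
OrdinaryTree S = NumBoundary S 2 × NumRadial S 1

-- A longest chord joins two rim points n - 1 steps apart; there are 2n - 1 of them. In a plane
-- tree two longest chords share an endpoint and three would close a triangle, so each tree has at
-- most two; as the n trees share all 2n - 1 of them, one tree T has exactly one and every other
-- tree exactly two, b – b+n-1 and b+n – b. Every chord of a plane connected graph covers a
-- boundary edge (a path from the rim point just inside it to the centre can only descend through
-- shorter nested chords), so the other trees have at least two boundary edges and T at least one.
-- A radial edge of another tree can only end at b, b+n-1 or b+n, and any two of these would close
-- a cycle through the centre, so it has at most one radial edge, and being connected at least one.
-- Counting the 2n - 1 boundary and the 2n - 1 radial edges forces equality everywhere and leaves T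
-- with n radial edges; these avoid the inside of T's longest chord and not both of its ends, so
-- they lie in, and hence fill, a block of n consecutive rim points.

module Submission where

open import Defs
open import Data.Nat using (ℕ; zero; suc; _+_; _*_; _∸_; _<_; _≤_; NonZero; z≤n; s≤s)
open import Data.Nat.Properties
open import Data.Nat.DivMod using (_%_; m%n<n; m%n%n≡m%n; %-distribˡ-+; [m+n]%n≡m%n; m<n⇒m%n≡m; n%n≡0)
open import Data.Fin as Fin using (Fin; zero; suc; toℕ; fromℕ)
open import Data.Fin.Properties using (toℕ-injective; toℕ<n; toℕ-fromℕ<; toℕ-fromℕ)
open import Data.Bool using (true; false; if_then_else_)
open import Data.List using (List; []; _∷_; _++_; length; map; filter; upTo; allFin)
open import Data.List.Properties using (length-map; length-++-sucʳ; length-upTo; length-tabulate)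
open import Data.List.Membership.Propositional using (_∈_)
open import Data.List.Membership.Propositional.Properties
  using (∈-∃++; ∈-++⁻; ∈-++⁺ˡ; ∈-++⁺ʳ; ∈-map⁺; ∈-map⁻; ∈-upTo⁺; ∈-allFin; ∈-filter⁺; ∈-filter⁻;
         ∈-length)
open import Data.List.Relation.Binary.Subset.Propositional using (_⊆_)
open import Data.List.Relation.Unary.Any using (here; there)
open import Data.List.Relation.Unary.All as All using ([]; _∷_)
open import Data.List.Relation.Unary.AllPairs using ([]; _∷_)
open import Data.List.Relation.Unary.Linked using ([-]; _∷_)
open import Data.List.Relation.Unary.Unique.Propositional using (Unique)
open import Data.List.Relation.Unary.Unique.Propositional.Properties using (map⁺; filter⁺; allFin⁺)
open import Data.Vec.Functional using (Vector)
open import Algebra.Properties.CommutativeMonoid.Sum +-0-commutativeMonoid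
  using (sum; sum-syntax; sum-cong-≗; ∑-distrib-+; sum-replicate-zero)
open import Data.Product using (Σ; ∃; ∃₂; _×_; _,_; proj₁; proj₂)
open import Data.Sum using (_⊎_; inj₁; inj₂)
open import Data.Empty using (⊥; ⊥-elim)
open import Data.Unit using (tt)
open import Function using (_∘_; id; flip; case_of_)
open import Function.Bundles using (_⇔_; mk⇔; Equivalence)
open import Relation.Binary.PropositionalEquality
open import Relation.Binary.Construct.Closure.ReflexiveTransitive using (Star; ε; _◅_)
open import Relation.Nullary using (¬_; Dec; does; yes; no)
open import Relation.Nullary.Decidable using (map′; decidable-stable; dec-true; dec-false)

x≤y≤1+x⇒y≡x⊎y≡1+x : ∀ {x y} → x ≤ y → y ≤ suc x → y ≡ x ⊎ y ≡ suc x
x≤y≤1+x⇒y≡x⊎y≡1+x x≤y y≤1+x with m≤n⇒m<n∨m≡n y≤1+x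
... | inj₁ y<1+x = inj₁ (≤-antisym (≤-pred y<1+x) x≤y)
... | inj₂ y≡1+x = inj₂ y≡1+x

module _ {d : ℕ} .{{_ : NonZero d}} where

  [m%d+n]%d≡[m+n]%d : ∀ x y → (x % d + y) % d ≡ (x + y) % d
  [m%d+n]%d≡[m+n]%d x y = begin
    (x % d + y) % d           ≡⟨ %-distribˡ-+ (x % d) y d ⟩
    (x % d % d + y % d) % d   ≡⟨ cong (λ z → (z + y % d) % d) (m%n%n≡m%n x d) ⟩
    (x % d + y % d) % d       ≡⟨ %-distribˡ-+ x y d ⟨
    (x + y) % d               ∎
    where open ≡-Reasoning

  +-%-cases : ∀ {x y z} → x < d → y < d → (x + y) % d ≡ z → x + y ≡ z ⊎ x + y ≡ z + d
  +-%-cases {x} {y} {z} x<d y<d eq with x + y <? d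
  ... | yes x+y<d = inj₁ (trans (sym (m<n⇒m%n≡m x+y<d)) eq)
  ... | no x+y≮d = inj₂ (begin
    x + y            ≡⟨ m∸n+n≡m d≤x+y ⟨
    x + y ∸ d + d    ≡⟨ cong (_+ d) wrapped ⟩
    z + d            ∎)
    where
    open ≡-Reasoning
    d≤x+y : d ≤ x + y
    d≤x+y = ≮⇒≥ x+y≮d
    wrapped : x + y ∸ d ≡ z
    wrapped = begin
      x + y ∸ d             ≡⟨ m<n⇒m%n≡m (m<n+o⇒m∸n<o (x + y) d (+-mono-< x<d y<d)) ⟨
      (x + y ∸ d) % d       ≡⟨ [m+n]%n≡m%n (x + y ∸ d) d ⟨
      (x + y ∸ d + d) % d   ≡⟨ cong (_% d) (m∸n+n≡m d≤x+y) ⟩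
      (x + y) % d           ≡⟨ eq ⟩
      z                     ∎

-- Finite sums

+-squeeze : ∀ {a b c d} → a ≤ b → c ≤ d → a + c ≡ b + d → a ≡ b × c ≡ d
+-squeeze {a} {b} {c} {d} a≤b c≤d eq = a≡b , +-cancelˡ-≡ a c d (trans eq (cong (_+ d) (sym a≡b)))
  where
  a≡b : a ≡ b
  a≡b = ≤-antisym a≤b (+-cancelʳ-≤ c b a (≤-trans (+-monoʳ-≤ b c≤d) (≤-reflexive (sym eq))))

∑-const : ∀ n b → ∑[ j < n ] b ≡ n * b
∑-const zero    b = refl
∑-const (suc n) b = cong (b +_) (∑-const n b)

∑-mono : ∀ {n} {f g : Vector ℕ n} → (∀ j → f j ≤ g j) → sum f ≤ sum g
∑-mono {zero}  f≤g = z≤n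
∑-mono {suc n} f≤g = +-mono-≤ (f≤g zero) (∑-mono (f≤g ∘ suc))

∑-squeeze : ∀ {n} {f g : Vector ℕ n} → (∀ j → f j ≤ g j) → sum f ≡ sum g → ∀ j → f j ≡ g j
∑-squeeze {suc n} {f} {g} f≤g ∑f≡∑g j with +-squeeze (f≤g zero) (∑-mono (f≤g ∘ suc)) ∑f≡∑g
∑-squeeze {suc n} f≤g ∑f≡∑g zero    | f₀≡g₀ , _ = f₀≡g₀
∑-squeeze {suc n} f≤g ∑f≡∑g (suc j) | _ , ∑f′≡∑g′ = ∑-squeeze (f≤g ∘ suc) ∑f′≡∑g′ j

∑<*⇒∃< : ∀ {n} b (f : Vector ℕ n) → sum f < n * b → ∃ λ i → f i < b
∑<*⇒∃< {suc n} b f ∑f<[1+n]b with f zero <? b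
... | yes f₀<b = zero , f₀<b
... | no f₀≮b = let i , fᵢ<b = ∑<*⇒∃< b (f ∘ suc) ∑f′<nb in suc i , fᵢ<b
  where
  ∑f′<nb : ∑[ j < n ] f (suc j) < n * b
  ∑f′<nb = +-cancelˡ-< b _ _ (≤-<-trans (+-monoˡ-≤ _ (≮⇒≥ f₀≮b)) ∑f<[1+n]b)

spike : ∀ {n} → Fin n → ℕ → ℕ → Vector ℕ n
spike i a b j = if does (i Fin.≟ j) then a else b

spike-same : ∀ {n} (i : Fin n) a b → spike i a b i ≡ a
spike-same i a b = cong (if_then a else b) (dec-true (i Fin.≟ i) refl)

spike-other : ∀ {n} {i j : Fin n} a b → j ≢ i → spike i a b j ≡ b
spike-other {i = i} {j} a b j≢i = cong (if_then a else b) (dec-false (i Fin.≟ j) (j≢i ∘ sym))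

pointwise-spike : ∀ {n} (R : ℕ → ℕ → Set) {f : Vector ℕ n} i {a b} →
                  R (f i) a → (∀ j → j ≢ i → R (f j) b) → ∀ j → R (f j) (spike i a b j)
pointwise-spike R {f} i {a} {b} Rfᵢa Rfⱼb j with j Fin.≟ i
... | yes refl = subst (R (f i)) (sym (spike-same i a b)) Rfᵢa
... | no  j≢i  = subst (R (f j)) (sym (spike-other a b j≢i)) (Rfⱼb j j≢i)

∑-spike : ∀ {n} (i : Fin (suc n)) a b → sum (spike i a b) ≡ a + n * b
∑-spike {n}     zero    a b = cong (a +_) (∑-const n b)
∑-spike {suc n} (suc i) a b = begin
  b + sum (spike i a b)  ≡⟨ cong (b +_) (∑-spike i a b) ⟩
  b + (a + n * b)        ≡⟨ +-assoc b a (n * b) ⟨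
  b + a + n * b          ≡⟨ cong (_+ n * b) (+-comm b a) ⟩
  a + b + n * b          ≡⟨ +-assoc a b (n * b) ⟩
  a + suc n * b          ∎
  where open ≡-Reasoning

module _ {A : Set} {n : ℕ} (f : A → Fin n) where

  fibre : Fin n → List A → List A
  fibre j = filter (λ x → f x Fin.≟ j)

  length-fibre-∷ : ∀ x xs j → length (fibre j (x ∷ xs)) ≡ spike (f x) 1 0 j + length (fibre j xs)
  length-fibre-∷ x xs j with does (f x Fin.≟ j)
  ... | true  = refl
  ... | false = refl

  ∑-length-fibre : ∀ xs → ∑[ j < n ] length (fibre j xs) ≡ length xs
  ∑-length-fibre []       = sum-replicate-zero n
  ∑-length-fibre (x ∷ xs) = begin
    ∑[ j < n ] length (fibre j (x ∷ xs))                    ≡⟨ sum-cong-≗ (length-fibre-∷ x xs) ⟩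
    ∑[ j < n ] (spike (f x) 1 0 j + length (fibre j xs))    ≡⟨ ∑-distrib-+ (spike (f x) 1 0) _ ⟩
    sum (spike (f x) 1 0) + ∑[ j < n ] length (fibre j xs)  ≡⟨ cong₂ _+_ (∑-indicator (f x)) (∑-length-fibre xs) ⟩
    suc (length xs)                                         ∎
    where
    open ≡-Reasoning
    ∑-indicator : ∀ {n} (i : Fin n) → sum (spike i 1 0) ≡ 1
    ∑-indicator {suc n} i = trans (∑-spike i 1 0) (cong suc (*-zeroʳ n))

-- Counting with duplicate-free lists

module _ {A : Set} where

  unique-⊆⇒length≤ : ∀ {xs ys : List A} → Unique xs → xs ⊆ ys → length xs ≤ length ys
  unique-⊆⇒length≤ {[]}     _             _     = z≤n
  unique-⊆⇒length≤ {x ∷ xs} (x∉xs ∷ uxs) xs⊆ys with ys₁ , ys₂ , refl ← ∈-∃++ (xs⊆ys (here refl)) =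
    subst (suc (length xs) ≤_) (sym (length-++-sucʳ ys₁ x ys₂)) (s≤s (unique-⊆⇒length≤ uxs xs⊆ys₁++ys₂))
    where
    xs⊆ys₁++ys₂ : xs ⊆ ys₁ ++ ys₂
    xs⊆ys₁++ys₂ y∈xs with ∈-++⁻ ys₁ (xs⊆ys (there y∈xs))
    ... | inj₁ y∈ys₁          = ∈-++⁺ˡ y∈ys₁
    ... | inj₂ (here refl)    = ⊥-elim (All.lookup x∉xs y∈xs refl)
    ... | inj₂ (there y∈ys₂)  = ∈-++⁺ʳ ys₁ y∈ys₂

  pairwise-equal⇒length≤1 : ∀ {xs : List A} → Unique xs → (∀ {x y} → x ∈ xs → y ∈ xs → x ≡ y) →
                            length xs ≤ 1
  pairwise-equal⇒length≤1 {[]}    _   _    = z≤n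
  pairwise-equal⇒length≤1 {x ∷ _} uxs all≡ =
    unique-⊆⇒length≤ {ys = x ∷ []} uxs (λ y∈xs → here (all≡ y∈xs (here refl)))

  no-three-distinct⇒length≤2 : ∀ {xs : List A} → Unique xs →
    (∀ {x y z} → x ∈ xs → y ∈ xs → z ∈ xs → x ≢ y → x ≢ z → y ≢ z → ⊥) → length xs ≤ 2
  no-three-distinct⇒length≤2 {[]}          _ _ = z≤n
  no-three-distinct⇒length≤2 {_ ∷ []}      _ _ = s≤s z≤n
  no-three-distinct⇒length≤2 {_ ∷ _ ∷ []}  _ _ = s≤s (s≤s z≤n)
  no-three-distinct⇒length≤2 {_ ∷ _ ∷ _ ∷ _} ((x≢y ∷ x≢z ∷ _) ∷ (y≢z ∷ _) ∷ _) no-three =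
    ⊥-elim (no-three (here refl) (there (here refl)) (there (there (here refl))) x≢y x≢z y≢z)

  distinct⇒2≤length : ∀ {xs : List A} {x y} → x ∈ xs → y ∈ xs → x ≢ y → 2 ≤ length xs
  distinct⇒2≤length x∈xs y∈xs x≢y = unique-⊆⇒length≤ ((x≢y ∷ []) ∷ [] ∷ [])
    λ { (here refl) → x∈xs ; (there (here refl)) → y∈xs }

  1≤length⇒∃∈ : ∀ {xs : List A} → 1 ≤ length xs → ∃ (_∈ xs)
  1≤length⇒∃∈ {x ∷ _} _ = x , here refl

  2≤length⇒∃-distinct : ∀ {xs : List A} → Unique xs → 2 ≤ length xs →
                        ∃₂ λ x y → x ∈ xs × y ∈ xs × x ≢ y
  2≤length⇒∃-distinct {_ ∷ []}    _                  (s≤s ())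
  2≤length⇒∃-distinct {x ∷ y ∷ _} ((x≢y ∷ _) ∷ _) _ = x , y , here refl , there (here refl) , x≢y

  HasCard-mono : ∀ {P Q : A → Set} {k l} → (∀ a → P a → Q a) → HasCard P k → HasCard Q l → k ≤ l
  HasCard-mono P⇒Q (xs , uxs , refl , xs≈P) (ys , _ , refl , ys≈Q) =
    unique-⊆⇒length≤ uxs (λ {a} a∈xs → Equivalence.from (ys≈Q a) (P⇒Q a (Equivalence.to (xs≈P a) a∈xs)))

  HasCard-functional : ∀ {P : A → Set} {k l} → HasCard P k → HasCard P l → k ≡ l
  HasCard-functional #P≡k #P≡l =
    ≤-antisym (HasCard-mono (λ _ → id) #P≡k #P≡l) (HasCard-mono (λ _ → id) #P≡l #P≡k)

  HasCard-image : ∀ {B : Set} {F : A → B} {P Q : B → Set} {k} → (∀ {x y} → F x ≡ F y → x ≡ y) →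
                  (∀ b → Q b → ∃ λ a → b ≡ F a) → (∀ a → Q (F a)) →
                  HasCard (P ∘ F) k → HasCard (λ b → P b × Q b) k
  HasCard-image {F = F} {P} {Q} F-injective Q⇒image Q-image (xs , uxs , |xs|≡k , xs≈P∘F) =
    map F xs , map⁺ F-injective uxs , trans (length-map F xs) |xs|≡k , λ b → mk⇔ (to b) (from b)
    where
    to : ∀ b → b ∈ map F xs → P b × Q b
    to b b∈Fxs with a , a∈xs , refl ← ∈-map⁻ F b∈Fxs = Equivalence.to (xs≈P∘F a) a∈xs , Q-image a
    from : ∀ b → P b × Q b → b ∈ map F xs
    from b (Pb , Qb) with a , refl ← Q⇒image b Qb = ∈-map⁺ F (Equivalence.from (xs≈P∘F a) Pb)

module Rim (n : ℕ) where

  toℕ-shift : ∀ a t → toℕ (shift n a t) ≡ (toℕ a + t) % m n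
  toℕ-shift a t = toℕ-fromℕ< _

  pos<m : ∀ a v → pos n a v < m n
  pos<m a v = m%n<n (toℕ v + (m n ∸ toℕ a)) (m n)

  shift-pos : ∀ a v → shift n a (pos n a v) ≡ v
  shift-pos a v = toℕ-injective (begin
    toℕ (shift n a (pos n a v))                ≡⟨ toℕ-shift a _ ⟩
    (toℕ a + (toℕ v + (m n ∸ toℕ a)) % m n) % m n ≡⟨ cong (_% m n) (+-comm (toℕ a) _) ⟩
    ((toℕ v + (m n ∸ toℕ a)) % m n + toℕ a) % m n ≡⟨ [m%d+n]%d≡[m+n]%d (toℕ v + (m n ∸ toℕ a)) (toℕ a) ⟩
    (toℕ v + (m n ∸ toℕ a) + toℕ a) % m n      ≡⟨ cong (_% m n) (+-assoc (toℕ v) _ _) ⟩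
    (toℕ v + (m n ∸ toℕ a + toℕ a)) % m n      ≡⟨ cong (λ z → (toℕ v + z) % m n) (m∸n+n≡m (<⇒≤ (toℕ<n a))) ⟩
    (toℕ v + m n) % m n                        ≡⟨ [m+n]%n≡m%n (toℕ v) (m n) ⟩
    toℕ v % m n                                ≡⟨ m<n⇒m%n≡m (toℕ<n v) ⟩
    toℕ v                                      ∎)
    where open ≡-Reasoning

  pos-injective : ∀ a {v w} → pos n a v ≡ pos n a w → v ≡ w
  pos-injective a {v} {w} eq = begin
    v                     ≡⟨ shift-pos a v ⟨
    shift n a (pos n a v) ≡⟨ cong (shift n a) eq ⟩
    shift n a (pos n a w) ≡⟨ shift-pos a w ⟩
    w                     ∎
    where open ≡-Reasoning

  pos-self : ∀ a → pos n a a ≡ 0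
  pos-self a = trans (cong (_% m n) (m+[n∸m]≡n (<⇒≤ (toℕ<n a)))) (n%n≡0 (m n))

  pos≡0⇒≡ : ∀ a v → pos n a v ≡ 0 → v ≡ a
  pos≡0⇒≡ a v eq = pos-injective a (trans eq (sym (pos-self a)))

  pos-shift : ∀ a c t → pos n a (shift n c t) ≡ (pos n a c + t) % m n
  pos-shift a c t = begin
    (toℕ (shift n c t) + (m n ∸ toℕ a)) % m n     ≡⟨ cong (λ z → (z + (m n ∸ toℕ a)) % m n) (toℕ-shift c t) ⟩
    ((toℕ c + t) % m n + (m n ∸ toℕ a)) % m n     ≡⟨ [m%d+n]%d≡[m+n]%d (toℕ c + t) _ ⟩
    (toℕ c + t + (m n ∸ toℕ a)) % m n             ≡⟨ cong (_% m n) (+-comm (toℕ c + t) _) ⟩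
    ((m n ∸ toℕ a) + (toℕ c + t)) % m n           ≡⟨ cong (_% m n) (+-assoc (m n ∸ toℕ a) (toℕ c) t) ⟨
    ((m n ∸ toℕ a) + toℕ c + t) % m n             ≡⟨ cong (λ z → (z + t) % m n) (+-comm (m n ∸ toℕ a) (toℕ c)) ⟩
    (toℕ c + (m n ∸ toℕ a) + t) % m n             ≡⟨ [m%d+n]%d≡[m+n]%d (toℕ c + (m n ∸ toℕ a)) t ⟨
    (pos n a c + t) % m n                         ∎
    where open ≡-Reasoning

  pos-shift-self : ∀ a {t} → t < m n → pos n a (shift n a t) ≡ t
  pos-shift-self a {t} t<m = trans (pos-shift a a t) (trans (cong (λ z → (z + t) % m n) (pos-self a)) (m<n⇒m%n≡m t<m))

  pos≡⇒≡shift : ∀ a v {t} → pos n a v ≡ t → v ≡ shift n a t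
  pos≡⇒≡shift a v eq = trans (sym (shift-pos a v)) (cong (shift n a) eq)

  pos-add : ∀ a c v → pos n a c + pos n c v ≡ pos n a v ⊎ pos n a c + pos n c v ≡ pos n a v + m n
  pos-add a c v = +-%-cases (pos<m a c) (pos<m c v) (begin
    (pos n a c + pos n c v) % m n   ≡⟨ pos-shift a c (pos n c v) ⟨
    pos n a (shift n c (pos n c v)) ≡⟨ cong (pos n a) (shift-pos c v) ⟩
    pos n a v                       ∎)
    where open ≡-Reasoning

  pos-add-< : ∀ a c v → pos n a c + pos n c v < m n → pos n a c + pos n c v ≡ pos n a v
  pos-add-< a c v sum<m with pos-add a c v
  ... | inj₁ eq = eq
  ... | inj₂ eq = ⊥-elim (<⇒≱ sum<m (subst (m n ≤_) (sym eq) (m≤n+m (m n) _)))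

  pos-shift-< : ∀ a c {t} → pos n a c + t < m n → pos n a (shift n c t) ≡ pos n a c + t
  pos-shift-< a c {t} sum<m = trans (pos-shift a c t) (m<n⇒m%n≡m sum<m)

  pos-shift-≥ : ∀ a c {t} → t < m n → m n ≤ pos n a c + t → pos n a (shift n c t) + m n ≡ pos n a c + t
  pos-shift-≥ a c {t} t<m m≤sum with +-%-cases (pos<m a c) t<m (sym (pos-shift a c t))
  ... | inj₂ eq = sym eq
  ... | inj₁ eq = ⊥-elim (<⇒≱ (pos<m a (shift n c t)) (subst (m n ≤_) eq m≤sum))

  pos-add-≤ : ∀ a c v → pos n a c ≤ pos n a v → pos n a c + pos n c v ≡ pos n a v
  pos-add-≤ a c v ac≤av with pos-add a c v
  ... | inj₁ eq = eq
  ... | inj₂ eq = ⊥-elim (<⇒≱ (+-monoʳ-< (pos n a c) (pos<m c v)) (begin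
    pos n a c + m n          ≤⟨ +-monoˡ-≤ (m n) ac≤av ⟩
    pos n a v + m n          ≡⟨ eq ⟨
    pos n a c + pos n c v    ∎))
    where open ≤-Reasoning

  pos-≢ : ∀ a {v w} → pos n a v ≢ pos n a w → v ≢ w
  pos-≢ a a→v≢a→w v≡w = a→v≢a→w (cong (pos n a) v≡w)

  pos≡suc⇒≢ : ∀ a c {t} → pos n a c ≡ suc t → a ≢ c
  pos≡suc⇒≢ a c a→c≡1+t refl = case trans (sym a→c≡1+t) (pos-self a) of λ ()

  pos-sym : ∀ a c → a ≢ c → pos n a c + pos n c a ≡ m n
  pos-sym a c a≢c with pos-add a c a
  ... | inj₂ eq = trans eq (cong (_+ m n) (pos-self a))
  ... | inj₁ eq = ⊥-elim (a≢c (sym (pos≡0⇒≡ a c (m+n≡0⇒m≡0 (pos n a c) (trans eq (pos-self a))))))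

  pos-flip : ∀ a c {t u} → a ≢ c → pos n a c ≡ t → t + u ≡ m n → pos n c a ≡ u
  pos-flip a c {t} a≢c a→c≡t t+u≡m =
    +-cancelˡ-≡ t (pos n c a) _ (trans (cong (_+ pos n c a) (sym a→c≡t)) (trans (pos-sym a c a≢c) (sym t+u≡m)))

  offset+offset<m : ∀ d e → offset n d + offset n e < m n
  offset+offset<m d e = s≤s (+-mono-≤ (toℕ<n d) (toℕ<n e))

  offset<m : ∀ d → offset n d < m n
  offset<m d = ≤-<-trans (m≤m+n (offset n d) (offset n d)) (offset+offset<m d d)

  positions-below⇒length≤ : ∀ b {t} {xs : List (Fin (m n))} → Unique xs →
                            (∀ {v} → v ∈ xs → pos n b v < t) → length xs ≤ t
  positions-below⇒length≤ b {t} {xs} uxs below = begin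
    length xs                  ≡⟨ length-map (pos n b) xs ⟨
    length (map (pos n b) xs)  ≤⟨ unique-⊆⇒length≤ (map⁺ (pos-injective b) uxs) in-range ⟩
    length (upTo t)            ≡⟨ length-upTo t ⟩
    t                          ∎
    where
    open ≤-Reasoning
    in-range : map (pos n b) xs ⊆ upTo t
    in-range p∈ with v , v∈xs , refl ← ∈-map⁻ (pos n b) p∈ = ∈-upTo⁺ (below v∈xs)

  fills-block : ∀ {P : Fin (m n) → Set} b {t} → (∀ v → Dec (P v)) → HasCard P t →
                (∀ v → P v → pos n b v < t) → ∀ v → pos n b v < t → P v
  fills-block b {t} P? (xs , uxs , |xs|≡t , xs≈P) within v b→v<t with P? v
  ... | yes Pv = Pv
  ... | no ¬Pv = ⊥-elim (<-irrefl |xs|≡t (positions-below⇒length≤ b (All.tabulate v∉xs ∷ uxs) in-block))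
    where
    v∉xs : ∀ {w} → w ∈ xs → v ≢ w
    v∉xs w∈xs refl = ¬Pv (Equivalence.to (xs≈P v) w∈xs)
    in-block : ∀ {w} → w ∈ v ∷ xs → pos n b w < t
    in-block (here refl)  = b→v<t
    in-block (there w∈xs) = within _ (Equivalence.to (xs≈P _) w∈xs)

-- Graphs on the wheel

rim-injective : ∀ {n a b} → rim {n} a ≡ rim b → a ≡ b
rim-injective refl = refl

centre≢rim : ∀ {n a} → centre {n} ≢ rim a
centre≢rim ()

Star-first : ∀ {A : Set} {R : A → A → Set} {x y} → Star R x y → x ≢ y → ∃ λ z → R x z
Star-first ε        x≢x = ⊥-elim (x≢x refl)
Star-first (r ◅ _) _   = _ , r

module _ {n : ℕ} {S : EdgeSet n} where

  open Rim n

  Adj-sym : ∀ {u v} → Adj S u v → Adj S v u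
  Adj-sym (e , Se , inj₁ ends) = e , Se , inj₂ ends
  Adj-sym (e , Se , inj₂ ends) = e , Se , inj₁ ends

  adj-rad : ∀ {v} → S (rad v) → Adj S centre (rim v)
  adj-rad {v} Sv = rad v , Sv , inj₁ (refl , refl)

  adj-chord : ∀ {a d} → S (chord a d) → Adj S (rim a) (rim (shift n a (offset n d)))
  adj-chord {a} {d} Sad = chord a d , Sad , inj₁ (refl , refl)

  triangle : ∀ {u v w} → u ≢ v → u ≢ w → v ≢ w →
             Adj S u v → Adj S v w → Adj S w u → HasCycle S
  triangle {u} {v} {w} u≢v u≢w v≢w uv vw wu =
    u , v ∷ [] , w , s≤s z≤n ,
    ((u≢v ∷ u≢w ∷ []) ∷ (v≢w ∷ []) ∷ [] ∷ []) ,
    (uv ∷ vw ∷ [-]) , wu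

  square : ∀ {u v w x} → u ≢ v → u ≢ w → u ≢ x → v ≢ w → v ≢ x → w ≢ x →
           Adj S u v → Adj S v w → Adj S w x → Adj S x u → HasCycle S
  square {u} {v} {w} {x} u≢v u≢w u≢x v≢w v≢x w≢x uv vw wx xu =
    u , v ∷ w ∷ [] , x , s≤s z≤n ,
    ((u≢v ∷ u≢w ∷ u≢x ∷ []) ∷ (v≢w ∷ v≢x ∷ []) ∷ (w≢x ∷ []) ∷ [] ∷ []) ,
    (uv ∷ vw ∷ wx ∷ [-]) , xu

  rim-triangle : ∀ {a b c} → a ≢ b → a ≢ c → b ≢ c →
                 Adj S (rim a) (rim b) → Adj S (rim b) (rim c) → Adj S (rim c) (rim a) → HasCycle S
  rim-triangle a≢b a≢c b≢c = triangle (a≢b ∘ rim-injective) (a≢c ∘ rim-injective) (b≢c ∘ rim-injective)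

  radial-triangle : ∀ {a b} → a ≢ b → S (rad a) → S (rad b) → Adj S (rim a) (rim b) → HasCycle S
  radial-triangle a≢b Sa Sb ab =
    triangle centre≢rim centre≢rim (a≢b ∘ rim-injective) (adj-rad Sa) ab (Adj-sym (adj-rad Sb))

  radial-square : ∀ {a b c} → a ≢ b → a ≢ c → b ≢ c → S (rad a) → S (rad c) →
                  Adj S (rim a) (rim b) → Adj S (rim b) (rim c) → HasCycle S
  radial-square a≢b a≢c b≢c Sa Sc ab bc =
    square centre≢rim centre≢rim centre≢rim
      (a≢b ∘ rim-injective) (a≢c ∘ rim-injective) (b≢c ∘ rim-injective)
      (adj-rad Sa) ab bc (Adj-sym (adj-rad Sc))

  adj-centre : ∀ {y} → Adj S centre y → ∃ λ v → S (rad v)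
  adj-centre (rad v , Sv , _) = v , Sv
  adj-centre (chord _ _ , _ , inj₁ (() , _))
  adj-centre (chord _ _ , _ , inj₂ (_ , ()))

  some-radial : Connected S → ∃ λ v → S (rad v)
  some-radial connected = adj-centre (proj₂ (Star-first (connected centre (rim zero)) centre≢rim))

  radial-outside : IsPlane S → ∀ {a d v} → S (chord a d) → S (rad v) →
                   pos n a v ≡ 0 ⊎ offset n d ≤ pos n a v
  radial-outside plane {a} {d} {v} Sad Sv with pos n a v ≟ 0 | pos n a v <? offset n d
  ... | yes a→v≡0 | _          = inj₁ a→v≡0
  ... | no  a→v≢0 | yes inside = ⊥-elim (plane _ _ Sv Sad (n≢0⇒n>0 a→v≢0 , inside))
  ... | no  _     | no outside = inj₂ (≮⇒≥ outside)

  equal-chords : IsPlane S → ∀ {a c d} → S (chord a d) → S (chord c d) →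
                 pos n a c ≡ 0 ⊎ (offset n d ≤ pos n a c × pos n a c + offset n d ≤ m n)
  equal-chords plane {a} {c} {d} Sa Sc with offset n d ≤? pos n a c | pos n a c + offset n d ≤? m n
  ... | yes ℓ≤p | yes fits  = inj₂ (ℓ≤p , fits)
  ... | yes ℓ≤p | no  wraps = ⊥-elim (plane _ _ Sa Sc (inj₂ (ℓ<p , 0<q , q<ℓ)))
    where
    ℓ p q : ℕ
    ℓ = offset n d
    p = pos n a c
    q = pos n a (shift n c ℓ)
    q+m≡p+ℓ : q + m n ≡ p + ℓ
    q+m≡p+ℓ = pos-shift-≥ a c (offset<m d) (<⇒≤ (≰⇒> wraps))
    ℓ<p : ℓ < p
    ℓ<p = +-cancelʳ-< ℓ ℓ p (<-trans (offset+offset<m d d) (≰⇒> wraps))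
    0<q : 0 < q
    0<q = n≢0⇒n>0 λ q≡0 → wraps (≤-reflexive (trans (sym q+m≡p+ℓ) (cong (_+ m n) q≡0)))
    q<ℓ : q < ℓ
    q<ℓ = +-cancelʳ-< (m n) q ℓ (begin-strict
      q + m n  ≡⟨ q+m≡p+ℓ ⟩
      p + ℓ    <⟨ +-monoˡ-< ℓ (pos<m a c) ⟩
      m n + ℓ  ≡⟨ +-comm (m n) ℓ ⟩
      ℓ + m n  ∎)
      where open ≤-Reasoning
  ... | no ℓ≰p | _ with pos n a c ≟ 0
  ...   | yes p≡0 = inj₁ p≡0
  ...   | no  p≢0 = ⊥-elim (plane _ _ Sa Sc (inj₁ ((n≢0⇒n>0 p≢0 , p<ℓ) , ℓ<q)))
    where
    ℓ : ℕ
    ℓ = offset n d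
    p<ℓ : pos n a c < ℓ
    p<ℓ = ≰⇒> ℓ≰p
    ℓ<q : ℓ < pos n a (shift n c ℓ)
    ℓ<q = subst (ℓ <_) (sym (pos-shift-< a c (<-trans (+-monoˡ-< ℓ p<ℓ) (offset+offset<m d d))))
            (m<n+m ℓ (n≢0⇒n>0 p≢0))

module Wheel (k : ℕ) where

  n : ℕ
  n = suc (suc k)

  open Rim n

  longest boundary : Fin (m n) → Edge n
  longest a  = chord a (fromℕ k)
  boundary a = chord a zero

  offset-longest : offset n (fromℕ k) ≡ suc k
  offset-longest = cong suc (toℕ-fromℕ k)

  n<m : n < m n
  n<m = s≤s (s≤s (m≤n+m (suc k) k))

  suc-k<m : suc k < m n
  suc-k<m = <-trans (n<1+n (suc k)) n<m

  m≡1+[1+k]*2 : m n ≡ 1 + suc k * 2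
  m≡1+[1+k]*2 = cong suc (trans (cong (suc k +_) (sym (+-identityʳ (suc k)))) (*-comm 2 (suc k)))

  m<n*2 : m n < n * 2
  m<n*2 = ≤-reflexive (cong suc m≡1+[1+k]*2)

  BoundaryUnder : EdgeSet n → Fin (m n) → Fin (suc k) → Set
  BoundaryUnder S a d = ∃ λ c → pos n a c < offset n d × S (boundary c)

  -- The longest chords b – b+n-1 and c – b, where c = b+n.
  LongestPair : EdgeSet n → Fin (m n) → Fin (m n) → Set
  LongestPair S b c = S (longest b) × S (longest c) × pos n b c ≡ n

  module _ {S : EdgeSet n} where

    -- The first edge of a path from a+1, the rim point just inside a chord at a, to the centre.
    module _ (plane : IsPlane S) {a : Fin (m n)} {d : Fin k} (Sad : S (chord a (suc d))) where

      private
        u : Fin (m n)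
        u = shift n a 1

        a→u≡1 : pos n a u ≡ 1
        a→u≡1 = pos-shift-self a (offset<m zero)

        u-inside : StrictIn {n} a (suc d) u
        u-inside = subst (0 <_) (sym a→u≡1) (s≤s z≤n) , subst (_< offset n (suc d)) (sym a→u≡1) (s≤s (s≤s z≤n))

        a→beyond-u : ∀ t → 1 + t < m n → pos n a (shift n u t) ≡ 1 + t
        a→beyond-u t 1+t<m = trans (pos-shift-< a u (subst (λ x → x + t < m n) (sym a→u≡1) 1+t<m)) (cong (_+ t) a→u≡1)

      no-radial-next-to : ¬ S (rad (shift n a 1))
      no-radial-next-to Su = plane _ _ Su Sad u-inside

      chord-from-next : (∀ {e} → offset n e < offset n (suc d) → S (chord (shift n a 1) e) →
                                 BoundaryUnder S (shift n a 1) e) →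
                        ∀ {e} → S (chord (shift n a 1) e) → BoundaryUnder S a (suc d)
      chord-from-next shorter-covered {e} Sue with offset n e <? offset n (suc d)
      ... | yes shorter =
        let c , u→c<e , Sc = shorter-covered shorter Sue
            1+u→c<d′ : 1 + pos n u c < offset n (suc d)
            1+u→c<d′ = ≤-trans (s≤s u→c<e) shorter
            a→c≡1+u→c : pos n a c ≡ 1 + pos n u c
            a→c≡1+u→c = trans (cong (pos n a) (sym (shift-pos u c)))
                          (a→beyond-u (pos n u c) (<-trans 1+u→c<d′ (offset<m (suc d))))
        in c , subst (_< offset n (suc d)) (sym a→c≡1+u→c) 1+u→c<d′ , Sc
      ... | no longer = ⊥-elim (plane _ _ Sad Sue (inj₁ (u-inside , tip-outside)))
        where
        tip-outside : StrictOut {n} a (suc d) (shift n u (offset n e))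
        tip-outside = subst (offset n (suc d) <_) (sym (a→beyond-u (offset n e) (offset+offset<m zero e)))
                        (s≤s (≮⇒≥ longer))

      chord-into-next : ∀ {p e} → S (chord p e) → shift n p (offset n e) ≡ shift n a 1 → BoundaryUnder S a (suc d)
      chord-into-next {p} {e} Spe tip≡u with pos n a p + offset n e <? m n
      ... | yes fits = a , subst (_< offset n (suc d)) (sym (pos-self a)) (s≤s z≤n) , subst S (cong₂ chord p≡a e≡0) Spe
        where
        a→p+e≡0 : pos n a p + toℕ e ≡ 0
        a→p+e≡0 = suc-injective (begin
          suc (pos n a p + toℕ e)            ≡⟨ +-suc (pos n a p) (toℕ e) ⟨
          pos n a p + offset n e             ≡⟨ pos-shift-< a p fits ⟨
          pos n a (shift n p (offset n e))   ≡⟨ cong (pos n a) tip≡u ⟩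
          pos n a u                          ≡⟨ a→u≡1 ⟩
          1                                  ∎)
          where open ≡-Reasoning
        p≡a : p ≡ a
        p≡a = pos≡0⇒≡ a p (m+n≡0⇒m≡0 (pos n a p) a→p+e≡0)
        e≡0 : e ≡ zero
        e≡0 = toℕ-injective (m+n≡0⇒n≡0 (pos n a p) a→p+e≡0)
      ... | no wraps = ⊥-elim (plane _ _ Sad Spe (inj₂ (p-outside , tip-inside)))
        where
        p-outside : offset n (suc d) < pos n a p
        p-outside = +-cancelʳ-< (offset n e) (offset n (suc d)) (pos n a p) (begin-strict
          offset n (suc d) + offset n e       <⟨ offset+offset<m (suc d) e ⟩
          m n                                 <⟨ n<1+n (m n) ⟩
          1 + m n                             ≡⟨ cong (_+ m n) a→u≡1 ⟨
          pos n a u + m n                     ≡⟨ cong (λ x → pos n a x + m n) tip≡u ⟨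
          pos n a (shift n p (offset n e)) + m n ≡⟨ pos-shift-≥ a p (offset<m e) (≮⇒≥ wraps) ⟩
          pos n a p + offset n e              ∎)
          where open ≤-Reasoning
        tip-inside : StrictIn {n} a (suc d) (shift n p (offset n e))
        tip-inside = subst (StrictIn {n} a (suc d)) (sym tip≡u) u-inside

    covered-boundary : IsPlane S → Connected S → ∀ {a d} → S (chord a d) → BoundaryUnder S a d
    covered-boundary plane connected {d = d} = descend (offset n d) ≤-refl
      where
      -- ℓ bounds the length of the chord, which decreases along the descent.
      descend : ∀ ℓ {a d} → offset n d ≤ ℓ → S (chord a d) → BoundaryUnder S a d
      descend _       {a} {zero}  _      Sa  = a , subst (_< 1) (sym (pos-self a)) (s≤s z≤n) , Sa
      descend (suc ℓ) {a} {suc d} d′≤1+ℓ Sad =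
        first-step (proj₂ (Star-first (connected (rim (shift n a 1)) centre) (centre≢rim ∘ sym)))
        where
        first-step : ∀ {y} → Adj S (rim (shift n a 1)) y → BoundaryUnder S a (suc d)
        first-step (rad v , Sv , inj₁ (() , _))
        first-step (rad v , Sv , inj₂ (_ , v≡u)) =
          ⊥-elim (no-radial-next-to plane Sad (subst (S ∘ rad) (rim-injective v≡u) Sv))
        first-step (chord p e , Spe , inj₁ (p≡u , _)) =
          chord-from-next plane Sad (λ shorter → descend ℓ (≤-pred (<-≤-trans shorter d′≤1+ℓ)))
            (subst (λ x → S (chord x e)) (rim-injective p≡u) Spe)
        first-step (chord p e , Spe , inj₂ (_ , tip≡u)) = chord-into-next plane Sad Spe (rim-injective tip≡u)

    longest-positions : IsPlane S → ∀ {a c} → S (longest a) → S (longest c) →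
                        pos n a c ≡ 0 ⊎ pos n a c ≡ suc k ⊎ pos n a c ≡ n
    longest-positions plane {a} {c} Sa Sc with equal-chords plane Sa Sc
    ... | inj₁ a→c≡0 = inj₁ a→c≡0
    ... | inj₂ (ℓ≤p , p+ℓ≤m) = inj₂ (x≤y≤1+x⇒y≡x⊎y≡1+x
            (subst (_≤ pos n a c) offset-longest ℓ≤p)
            (+-cancelʳ-≤ (suc k) (pos n a c) n (subst (λ ℓ → pos n a c + ℓ ≤ m n) offset-longest p+ℓ≤m)))

    adj-longest : ∀ {a c} → S (longest a) → pos n a c ≡ suc k → Adj S (rim a) (rim c)
    adj-longest {a} {c} Sa a→c≡k = subst (λ x → Adj S (rim a) (rim x)) tip≡c (adj-chord Sa)
      where
      tip≡c : shift n a (offset n (fromℕ k)) ≡ c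
      tip≡c = trans (cong (shift n a) offset-longest) (sym (pos≡⇒≡shift a c a→c≡k))

    longest-triangle : IsPlane S → ∀ {a c e} → S (longest a) → S (longest c) → S (longest e) → c ≢ e →
                       pos n a c ≡ suc k → pos n a e ≡ n → HasCycle S
    longest-triangle plane {a} {c} {e} Sa Sc Se c≢e a→c≡k a→e≡n with longest-positions plane Sc Se
    ... | inj₁ c→e≡0 = ⊥-elim (c≢e (sym (pos≡0⇒≡ c e c→e≡0)))
    ... | inj₂ (inj₂ c→e≡n) =
      case +-cancelʳ-≡ n (suc k) 0 (trans (cong (suc k +_) (sym c→e≡n)) 1+k+c→e≡n) of λ ()
      where
      1+k+c→e≡n : suc k + pos n c e ≡ n
      1+k+c→e≡n = begin
        suc k + pos n c e      ≡⟨ cong (_+ pos n c e) a→c≡k ⟨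
        pos n a c + pos n c e  ≡⟨ pos-add-≤ a c e (subst₂ _≤_ (sym a→c≡k) (sym a→e≡n) (n≤1+n (suc k))) ⟩
        pos n a e              ≡⟨ a→e≡n ⟩
        n                      ∎
        where open ≡-Reasoning
    ... | inj₂ (inj₁ c→e≡k) =
      rim-triangle (pos≡suc⇒≢ a c a→c≡k) (pos≡suc⇒≢ a e a→e≡n) c≢e
        (adj-longest Sa a→c≡k) (adj-longest Sc c→e≡k)
        (adj-longest Se (pos-flip a e (pos≡suc⇒≢ a e a→e≡n) a→e≡n refl))

    no-three-longest : IsPlane S → ¬ HasCycle S → ∀ {a c e} → S (longest a) → S (longest c) → S (longest e) →
                       a ≢ c → a ≢ e → c ≢ e → ⊥
    no-three-longest plane acyclic {a} {c} {e} Sa Sc Se a≢c a≢e c≢e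
      with longest-positions plane Sa Sc | longest-positions plane Sa Se
    ... | inj₁ a→c≡0        | _                 = a≢c (sym (pos≡0⇒≡ a c a→c≡0))
    ... | inj₂ _            | inj₁ a→e≡0        = a≢e (sym (pos≡0⇒≡ a e a→e≡0))
    ... | inj₂ (inj₁ a→c≡k) | inj₂ (inj₁ a→e≡k) = c≢e (pos-injective a (trans a→c≡k (sym a→e≡k)))
    ... | inj₂ (inj₂ a→c≡n) | inj₂ (inj₂ a→e≡n) = c≢e (pos-injective a (trans a→c≡n (sym a→e≡n)))
    ... | inj₂ (inj₁ a→c≡k) | inj₂ (inj₂ a→e≡n) =
      acyclic (longest-triangle plane Sa Sc Se c≢e a→c≡k a→e≡n)
    ... | inj₂ (inj₂ a→c≡n) | inj₂ (inj₁ a→e≡k) =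
      acyclic (longest-triangle plane Sa Se Sc (c≢e ∘ sym) a→e≡k a→c≡n)

    longest-pair : IsPlane S → ∀ {a c} → S (longest a) → S (longest c) → a ≢ c → ∃₂ (LongestPair S)
    longest-pair plane {a} {c} Sa Sc a≢c with longest-positions plane Sa Sc
    ... | inj₁ a→c≡0        = ⊥-elim (a≢c (sym (pos≡0⇒≡ a c a→c≡0)))
    ... | inj₂ (inj₁ a→c≡k) = c , a , Sc , Sa , pos-flip a c a≢c a→c≡k (+-comm (suc k) n)
    ... | inj₂ (inj₂ a→c≡n) = a , c , Sa , Sc , a→c≡n

    radial-in-pair : IsPlane S → ∀ {b c v} → LongestPair S b c → S (rad v) →
                     pos n b v ≡ 0 ⊎ pos n b v ≡ suc k ⊎ pos n b v ≡ n
    radial-in-pair plane {b} {c} {v} (Sb , Sc , b→c≡n) Sv with radial-outside plane Sb Sv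
    ... | inj₁ b→v≡0 = inj₁ b→v≡0
    ... | inj₂ ℓ≤b→v with pos n b v ≤? n
    ...   | yes b→v≤n = inj₂ (x≤y≤1+x⇒y≡x⊎y≡1+x (subst (_≤ pos n b v) offset-longest ℓ≤b→v) b→v≤n)
    ...   | no  b→v≰n = ⊥-elim beyond-c
      where
      n+c→v≡b→v : n + pos n c v ≡ pos n b v
      n+c→v≡b→v = trans (cong (_+ pos n c v) (sym b→c≡n))
                    (pos-add-≤ b c v (subst (_≤ pos n b v) (sym b→c≡n) (<⇒≤ (≰⇒> b→v≰n))))
      beyond-c : ⊥
      beyond-c with radial-outside plane Sc Sv
      ... | inj₁ c→v≡0 =
        b→v≰n (≤-reflexive (trans (sym n+c→v≡b→v) (trans (cong (n +_) c→v≡0) (+-identityʳ n))))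
      ... | inj₂ ℓ≤c→v = <⇒≱ (pos<m b v)
              (subst (m n ≤_) n+c→v≡b→v (+-monoʳ-≤ n (subst (_≤ pos n c v) offset-longest ℓ≤c→v)))

    at-most-one-radial : IsPlane S → ¬ HasCycle S → ∀ {b c v w} → LongestPair S b c →
                         S (rad v) → S (rad w) → v ≡ w
    at-most-one-radial plane acyclic {b} {c} {v} {w} pair@(Sb , Sc , b→c≡n) Sv Sw =
      slots (radial-in-pair plane pair Sv) (radial-in-pair plane pair Sw)
      where
      b≢c : b ≢ c
      b≢c = pos≡suc⇒≢ b c b→c≡n
      c-b : Adj S (rim c) (rim b)
      c-b = adj-longest Sc (pos-flip b c b≢c b→c≡n refl)
      k≢n : suc k ≢ n
      k≢n ()
      to-c : ∀ x → pos n b x ≡ n → x ≡ c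
      to-c x b→x≡n = pos-injective b (trans b→x≡n (sym b→c≡n))
      b-and-far-end : ∀ {x y} → pos n b x ≡ 0 → pos n b y ≡ suc k → S (rad x) → S (rad y) → ⊥
      b-and-far-end {x} {y} b→x≡0 b→y≡k Sx Sy with refl ← pos≡0⇒≡ b x b→x≡0 =
        acyclic (radial-triangle (pos≡suc⇒≢ b y b→y≡k) Sx Sy (adj-longest Sb b→y≡k))
      b-and-c : ∀ {x y} → pos n b x ≡ 0 → pos n b y ≡ n → S (rad x) → S (rad y) → ⊥
      b-and-c {x} {y} b→x≡0 b→y≡n Sx Sy with refl ← pos≡0⇒≡ b x b→x≡0 | refl ← to-c y b→y≡n =
        acyclic (radial-triangle b≢c Sx Sy (Adj-sym c-b))
      far-end-and-c : ∀ {x y} → pos n b x ≡ suc k → pos n b y ≡ n → S (rad x) → S (rad y) → ⊥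
      far-end-and-c {x} {y} b→x≡k b→y≡n Sx Sy with refl ← to-c y b→y≡n =
        acyclic (radial-square (pos≡suc⇒≢ b x b→x≡k ∘ sym)
                   (pos-≢ b λ eq → k≢n (trans (sym b→x≡k) (trans eq b→c≡n))) b≢c
                   Sx Sy (Adj-sym (adj-longest Sb b→x≡k)) (Adj-sym c-b))
      slots : pos n b v ≡ 0 ⊎ pos n b v ≡ suc k ⊎ pos n b v ≡ n →
              pos n b w ≡ 0 ⊎ pos n b w ≡ suc k ⊎ pos n b w ≡ n → v ≡ w
      slots (inj₁ x)        (inj₁ y)        = pos-injective b (trans x (sym y))
      slots (inj₂ (inj₁ x)) (inj₂ (inj₁ y)) = pos-injective b (trans x (sym y))
      slots (inj₂ (inj₂ x)) (inj₂ (inj₂ y)) = pos-injective b (trans x (sym y))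
      slots (inj₁ x)        (inj₂ (inj₁ y)) = ⊥-elim (b-and-far-end x y Sv Sw)
      slots (inj₂ (inj₁ x)) (inj₁ y)        = ⊥-elim (b-and-far-end y x Sw Sv)
      slots (inj₁ x)        (inj₂ (inj₂ y)) = ⊥-elim (b-and-c x y Sv Sw)
      slots (inj₂ (inj₂ x)) (inj₁ y)        = ⊥-elim (b-and-c y x Sw Sv)
      slots (inj₂ (inj₁ x)) (inj₂ (inj₂ y)) = ⊥-elim (far-end-and-c x y Sv Sw)
      slots (inj₂ (inj₂ x)) (inj₂ (inj₁ y)) = ⊥-elim (far-end-and-c y x Sw Sv)

    two-boundaries : IsPlane S → Connected S → ∀ {b c} → LongestPair S b c →
                     ∃₂ λ c₁ c₂ → c₁ ≢ c₂ × S (boundary c₁) × S (boundary c₂)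
    two-boundaries plane connected {b} {c} (Sb , Sc , b→c≡n) =
      let c₁ , b→c₁<ℓ , S₁ = covered-boundary plane connected Sb
          c₂ , c→c₂<ℓ , S₂ = covered-boundary plane connected Sc
      in c₁ , c₂ , apart b→c₁<ℓ c→c₂<ℓ , S₁ , S₂
      where
      ℓ : ℕ
      ℓ = offset n (fromℕ k)
      apart : ∀ {x y} → pos n b x < ℓ → pos n c y < ℓ → x ≢ y
      apart {x} b→x<ℓ c→x<ℓ refl = <⇒≱ b→x<ℓ (begin
        ℓ                  ≤⟨ ≤-trans (toℕ<n (fromℕ k)) (n≤1+n (suc k)) ⟩
        n                  ≤⟨ m≤m+n n (pos n c x) ⟩
        n + pos n c x      ≡⟨ cong (_+ pos n c x) b→c≡n ⟨
        pos n b c + pos n c x  ≡⟨ pos-add-< b c x (subst (λ t → t + pos n c x < m n) (sym b→c≡n)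
                                    (+-monoʳ-< n (subst (pos n c x <_) offset-longest c→x<ℓ))) ⟩
        pos n b x          ∎)
        where open ≤-Reasoning

    -- The block starts at a+n-1 if that point is joined to the centre, and at a+n otherwise.
    special-block : IsPlane S → ¬ HasCycle S → ∀ {a} → S (longest a) → Dec (S (rad (shift n a (suc k)))) →
                    ∃ λ b → ∀ v → S (rad v) → pos n b v < n
    special-block plane acyclic {a} Sa (yes St) = t , within
      where
      t : Fin (m n)
      t = shift n a (suc k)
      a→t≡k : pos n a t ≡ suc k
      a→t≡k = pos-shift-self a suc-k<m
      within : ∀ v → S (rad v) → pos n t v < n
      within v Sv with radial-outside plane Sa Sv
      ... | inj₁ a→v≡0 with refl ← pos≡0⇒≡ a v a→v≡0 =
        ⊥-elim (acyclic (radial-triangle (pos≡suc⇒≢ a t a→t≡k) Sv St (adj-longest Sa a→t≡k)))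
      ... | inj₂ ℓ≤a→v = +-cancelˡ-< (suc k) (pos n t v) n (begin-strict
        suc k + pos n t v      ≡⟨ cong (_+ pos n t v) a→t≡k ⟨
        pos n a t + pos n t v  ≡⟨ pos-add-≤ a t v (subst₂ _≤_ (sym a→t≡k) refl
                                    (subst (_≤ pos n a v) offset-longest ℓ≤a→v)) ⟩
        pos n a v              <⟨ pos<m a v ⟩
        m n                    ≡⟨ +-comm n (suc k) ⟩
        suc k + n              ∎)
        where open ≤-Reasoning
    special-block plane acyclic {a} Sa (no ¬St) = b , within
      where
      b : Fin (m n)
      b = shift n a n
      a→b≡n : pos n a b ≡ n
      a→b≡n = pos-shift-self a n<m
      within : ∀ v → S (rad v) → pos n b v < n
      within v Sv with radial-outside plane Sa Sv
      ... | inj₁ a→v≡0 with refl ← pos≡0⇒≡ a v a→v≡0 =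
        subst (_< n) (sym (pos-flip a b (pos≡suc⇒≢ a b a→b≡n) a→b≡n refl)) (n<1+n (suc k))
      ... | inj₂ ℓ≤a→v with pos n a v ≟ suc k
      ...   | yes a→v≡k = ⊥-elim (¬St (subst (S ∘ rad) (pos≡⇒≡shift a v a→v≡k) Sv))
      ...   | no  a→v≢k = <-trans (+-cancelˡ-< n (pos n b v) (suc k) (begin-strict
        n + pos n b v          ≡⟨ cong (_+ pos n b v) a→b≡n ⟨
        pos n a b + pos n b v  ≡⟨ pos-add-≤ a b v (subst (_≤ pos n a v) (sym a→b≡n) n≤a→v) ⟩
        pos n a v              <⟨ pos<m a v ⟩
        n + suc k              ∎)) (n<1+n (suc k))
        where
        open ≤-Reasoning
        n≤a→v : n ≤ pos n a v
        n≤a→v = ≤∧≢⇒< (subst (_≤ pos n a v) offset-longest ℓ≤a→v) (a→v≢k ∘ sym)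

module TreeCounts {n : ℕ} {T : Fin n → EdgeSet n} (partition : Partition T) where

  treeOf : Edge n → Fin n
  treeOf e = proj₁ (partition e)

  ∈-treeOf : ∀ e → T (treeOf e) e
  ∈-treeOf e = proj₁ (proj₂ (partition e))

  treeOf-unique : ∀ {j e} → T j e → treeOf e ≡ j
  treeOf-unique {j} {e} Tje = sym (proj₂ (proj₂ (partition e)) j Tje)

  T? : ∀ j e → Dec (T j e)
  T? j e = map′ (λ eq → subst (λ i → T i e) eq (∈-treeOf e)) treeOf-unique (treeOf e Fin.≟ j)

  module Family {p : ℕ} (F : Fin p → Edge n) where

    members : Fin n → List (Fin p)
    members j = fibre (treeOf ∘ F) j (allFin p)

    count : Fin n → ℕ
    count j = length (members j)

    ∈-members⁺ : ∀ {j a} → T j (F a) → a ∈ members j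
    ∈-members⁺ {a = a} Tj = ∈-filter⁺ (λ x → treeOf (F x) Fin.≟ _) (∈-allFin a) (treeOf-unique Tj)

    ∈-members⁻ : ∀ {j a} → a ∈ members j → T j (F a)
    ∈-members⁻ {j} {a} a∈ = subst (λ i → T i (F a))
      (proj₂ (∈-filter⁻ (λ x → treeOf (F x) Fin.≟ j) {xs = allFin p} a∈)) (∈-treeOf (F a))

    members-unique : ∀ j → Unique (members j)
    members-unique j = filter⁺ (λ x → treeOf (F x) Fin.≟ j) (allFin⁺ p)

    count-HasCard : ∀ j → HasCard (λ a → T j (F a)) (count j)
    count-HasCard j = members j , members-unique j , refl , λ a → mk⇔ ∈-members⁻ ∈-members⁺

    ∑-count : sum count ≡ p
    ∑-count = trans (∑-length-fibre (treeOf ∘ F) (allFin p)) (length-tabulate id)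

module Decomposition (k : ℕ) (T : Fin (suc (suc k)) → EdgeSet (suc (suc k)))
                     (trees : ∀ i → IsPlaneSpanningTree (T i)) (partition : Partition T) where

  open Wheel k
  open Rim n
  open TreeCounts partition

  plane : ∀ j → IsPlane (T j)
  plane j = proj₁ (trees j)

  connected : ∀ j → Connected (T j)
  connected j = proj₁ (proj₂ (trees j))

  acyclic : ∀ j → ¬ HasCycle (T j)
  acyclic j = proj₂ (proj₂ (trees j))

  module L = Family longest
  module B = Family boundary
  module R = Family rad

  longest≤2 : ∀ j → L.count j ≤ 2
  longest≤2 j = no-three-distinct⇒length≤2 (L.members-unique j) λ a∈ c∈ e∈ →
    no-three-longest (plane j) (acyclic j) (L.∈-members⁻ a∈) (L.∈-members⁻ c∈) (L.∈-members⁻ e∈)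

  special-exists : ∃ λ i → L.count i < 2
  special-exists = ∑<*⇒∃< 2 L.count (subst (_< n * 2) (sym L.∑-count) m<n*2)

  special : Fin n
  special = proj₁ special-exists

  longest-profile : ∀ j → L.count j ≡ spike special 1 2 j
  longest-profile = ∑-squeeze
    (pointwise-spike _≤_ special (≤-pred (proj₂ special-exists)) (λ j _ → longest≤2 j))
    (trans L.∑-count (trans m≡1+[1+k]*2 (sym (∑-spike special 1 2))))

  longest-pair-of : ∀ j → j ≢ special → ∃₂ (LongestPair (T j))
  longest-pair-of j j≢s =
    let a , c , a∈ , c∈ , a≢c = 2≤length⇒∃-distinct (L.members-unique j)
                                   (≤-reflexive (sym (trans (longest-profile j) (spike-other 1 2 j≢s))))
    in longest-pair (plane j) (L.∈-members⁻ a∈) (L.∈-members⁻ c∈) a≢c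

  special-longest : ∃ λ a → T special (longest a)
  special-longest =
    let a , a∈ = 1≤length⇒∃∈ (≤-reflexive (sym (trans (longest-profile special) (spike-same special 1 2))))
    in a , L.∈-members⁻ a∈

  ordinary-radial : ∀ j → j ≢ special → R.count j ≡ 1
  ordinary-radial j j≢s = ≤-antisym
    (pairwise-equal⇒length≤1 (R.members-unique j) λ v∈ w∈ →
       at-most-one-radial (plane j) (acyclic j) (proj₂ (proj₂ (longest-pair-of j j≢s)))
         (R.∈-members⁻ v∈) (R.∈-members⁻ w∈))
    (∈-length (R.∈-members⁺ (proj₂ (some-radial (connected j)))))

  special-radial : R.count special ≡ n
  special-radial = +-cancelʳ-≡ (suc k) (R.count special) n (begin
    R.count special + suc k      ≡⟨ cong (R.count special +_) (*-identityʳ (suc k)) ⟨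
    R.count special + suc k * 1  ≡⟨ ∑-spike special (R.count special) 1 ⟨
    sum (spike special (R.count special) 1) ≡⟨ sum-cong-≗ (pointwise-spike _≡_ special refl ordinary-radial) ⟨
    sum R.count                  ≡⟨ R.∑-count ⟩
    n + suc k                    ∎)
    where open ≡-Reasoning

  boundary-profile : ∀ j → spike special 1 2 j ≡ B.count j
  boundary-profile = ∑-squeeze
    (pointwise-spike (flip _≤_) special special-boundary ordinary-boundaries)
    (trans (∑-spike special 1 2) (trans (sym m≡1+[1+k]*2) (sym B.∑-count)))
    where
    special-boundary : 1 ≤ B.count special
    special-boundary =
      let c , _ , Sc = covered-boundary (plane special) (connected special) (proj₂ special-longest)
      in ∈-length (B.∈-members⁺ Sc)
    ordinary-boundaries : ∀ j → j ≢ special → 2 ≤ B.count j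
    ordinary-boundaries j j≢s =
      let c₁ , c₂ , c₁≢c₂ , S₁ , S₂ =
            two-boundaries (plane j) (connected j) (proj₂ (proj₂ (longest-pair-of j j≢s)))
      in distinct⇒2≤length (B.∈-members⁺ S₁) (B.∈-members⁺ S₂) c₁≢c₂

  special-consecutive : ∃ λ b → ∀ v → T special (rad v) ⇔ (pos n b v < n)
  special-consecutive = b , λ v → mk⇔ (within v) (fills-block b (T? special ∘ rad) radials within v)
    where
    a : Fin (m n)
    a = proj₁ special-longest
    block : ∃ λ b → ∀ v → T special (rad v) → pos n b v < n
    block = special-block (plane special) (acyclic special) (proj₂ special-longest) (T? special (rad (shift n a (suc k))))
    b : Fin (m n)
    b = proj₁ block
    within : ∀ v → T special (rad v) → pos n b v < n
    within = proj₂ block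
    radials : HasCard (T special ∘ rad) n
    radials = subst (HasCard (T special ∘ rad)) special-radial (R.count-HasCard special)

  boundaries-HasCard : ∀ j → NumBoundary (T j) (B.count j)
  boundaries-HasCard j = HasCard-image (λ { refl → refl }) boundary-image (λ _ → refl) (B.count-HasCard j)
    where
    boundary-image : ∀ e → IsBoundary e → ∃ λ a → e ≡ boundary a
    boundary-image (chord a zero)    _ = a , refl
    boundary-image (chord a (suc _)) ()
    boundary-image (rad _)           ()

  radials-HasCard : ∀ j → NumRadial (T j) (R.count j)
  radials-HasCard j = HasCard-image (λ { refl → refl }) radial-image (λ _ → tt) (R.count-HasCard j)
    where
    radial-image : ∀ e → IsRadial e → ∃ λ a → e ≡ rad a
    radial-image (rad a) _ = a , refl
    radial-image (chord _ _) ()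

  special-tree : SpecialTree (T special)
  special-tree =
    subst (NumBoundary (T special)) (trans (sym (boundary-profile special)) (spike-same special 1 2)) (boundaries-HasCard special) ,
    subst (NumRadial (T special)) special-radial (radials-HasCard special) ,
    special-consecutive

  ordinary-tree : ∀ j → j ≢ special → OrdinaryTree (T j)
  ordinary-tree j j≢s =
    subst (NumBoundary (T j)) (trans (sym (boundary-profile j)) (spike-other 1 2 j≢s)) (boundaries-HasCard j) ,
    subst (NumRadial (T j)) (ordinary-radial j j≢s) (radials-HasCard j)

  special-unique : ∀ j → SpecialTree (T j) → j ≡ special
  special-unique j (_ , n-radials , _) = decidable-stable (j Fin.≟ special) λ j≢s →
    1≢n (HasCard-functional (proj₂ (ordinary-tree j j≢s)) n-radials)
    where
    1≢n : 1 ≢ n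
    1≢n ()

lemma4 : (n : ℕ) → 2 ≤ n → (T : Fin n → EdgeSet n) →
    (∀ i → IsPlaneSpanningTree (T i)) → Partition T →
    Σ (Fin n) λ i →
      (SpecialTree (T i) × (∀ j → j ≢ i → OrdinaryTree (T j))) ×
      (∀ j → SpecialTree (T j) × (∀ k → k ≢ j → OrdinaryTree (T k)) → j ≡ i)
lemma4 (suc (suc k)) (s≤s (s≤s z≤n)) T trees partition =
  special , (special-tree , ordinary-tree) , λ j (Sj , _) → special-unique j Sj
  where open Decomposition k T trees partition
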